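{- If $M$ is an $\mathbf{E}$-countermodel for $\varphi$ (i.e. any preference model with $M\not\models\varphi$), then for any choice function $rep$ the generated model $\mathrm{gen}(\mathrm{SMC}_{\mathbf{E}})$ is an $\mathbf{E}$-countermodel for $\varphi$, and there is a constant $C$, independent of $\varphi$ and $M$, such that $|W(\mathrm{gen}(\mathrm{SMC}_{\mathbf{E}}))|\le C\cdot|\varphi|^2$.
   Context: Formulas: $x\in\mathit{Var}\mid\neg\psi\mid\psi_1\wedge\psi_2\mid\Box\psi\mid\mathcal{O}(\psi_1\mid\psi_2)$; $|\varphi|$ is the number of symbols of $\varphi$; $\mathrm{Cond}(\varphi)=\{\alpha:\mathcal{O}(\gamma\mid\alpha)\text{ is a subformula of }\varphi\}$. A preference model $M=\langle W,\succeq,\mathbb{V}\rangle$: $W$ nonempty, $\succeq$ any binary relation on $W$, $\mathbb{V}\colon\mathit{Var}\to\mathcal{P}(W)$; $w_1\succ w_2$ iff $w_1\succeq w_2$ and not $w_2\succeq w_1$; $\max_\succ(U)=\{v\in U:\neg\exists u\in U,u\succ v\}$; $\mathrm{Bet}(v)=\{w:w\succ v\}$. Truth sets: $\|x\|=\mathbb{V}(x)$, $\|\neg\psi\|=W\setminus\|\psi\|$, $\|\psi_1\wedge\psi_2\|=\|\psi_1\|\cap\|\psi_2\|$, $\|\Box\beta\|=W$ if $\|\beta\|=W$ else $\emptyset$, $\|\mathcal{O}(\gamma\mid\alpha)\|=W$ if $\max_\succ(\|\alpha\|)\subseteq\|\gamma\|$ else $\emptyset$; $M\models\psi$ iff $\|\psi\|=W$.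 An $\mathbf{E}$-countermodel for $\varphi$ is any preference model $M$ with $M\not\models\varphi$. $rep$ assigns to each nonempty $S\subseteq W$ an element of $S$. $\mathit{Fal}(\varphi,M)=\{rep(W\setminus\|\varphi\|)\}\cup\{rep(W\setminus\|\beta\|):\Box\beta\text{ a subformula of }\varphi,M\not\models\Box\beta\}\cup\{rep(\max_\succ(\|\alpha\|)\setminus\|\gamma\|):\mathcal{O}(\gamma\mid\alpha)\text{ a subformula of }\varphi,M\not\models\mathcal{O}(\gamma\mid\alpha)\}$. $\mathrm{Sel}(U,\mathcal{A})=\{rep(\|\alpha\|\cap U):\alpha\in\mathcal{A},\|\alpha\|\cap U\neq\emptyset\}$. A block is a pair $\langle U,\succeq_U\rangle$ with $U\subseteq W$ and $\succeq_U$ a relation on $U$; $\mathrm{antichain}(U)=\langle U,\emptyset\rangle$. A composite construction $\langle L,\succeq_L,\mathcal{B}\rangle$ (labels $L$, relation $\succeq_L$ on $L$, $\mathcal{B}$ mapping labels to blocks) generates the model with worlds $\{(l,w):l\in L,w\in W(\mathcal{B}(l))\}$, $(l_1,w_1)\succeq^{gen}(l_2,w_2)$ iff $l_1\succeq_L l_2$ or ($l_1=l_2$ and $w_1\succeq_U w_2$ where $\mathcal{B}(l_1)=\langle U,\succeq_U\rangle$), and $(l,w)\in\mathbb{V}^{gen}(x)$ iff $w\in\mathbb{V}(x)$. $\mathrm{SMC}_{\mathbf{E}}$: labels $\mathtt{f}_v,\mathtt{orb}_v$ for $v\in\mathit{Fal}(\varphi,M)$ and $\mathtt{all}_1,\mathtt{all}_2,\mathtt{all}_3$;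 $\mathcal{B}(\mathtt{f}_v)=\mathrm{antichain}(\{v\})$, $\mathcal{B}(\mathtt{orb}_v)=\mathrm{antichain}(\mathrm{Sel}(\mathrm{Bet}(v),\mathrm{Cond}(\varphi)))$, $\mathcal{B}(\mathtt{all}_i)=\mathrm{antichain}(\mathrm{Sel}(W,\mathrm{Cond}(\varphi)))$; $\succeq_L$ consists exactly of the pairs $\mathtt{orb}_v\succeq_L\mathtt{f}_v$ and $\mathtt{all}_1\succeq_L\mathtt{orb}_v$ (for all $v$), and $\mathtt{all}_2\succeq_L\mathtt{all}_1$, $\mathtt{all}_3\succeq_L\mathtt{all}_2$, $\mathtt{all}_1\succeq_L\mathtt{all}_3$. -}

module Defs where

open import Data.Nat using (ℕ; suc; _+_; _*_; _≤_)
open import Data.Product using (Σ; _×_; _,_; Σ-syntax)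
open import Data.Sum using (_⊎_)
open import Data.Empty using (⊥)
open import Data.Unit using (⊤)
open import Data.List using (List; length)
open import Data.List.Membership.Propositional using (_∈_)
open import Data.Refinement using (Refinement; value)
open import Relation.Nullary using (¬_)
open import Relation.Binary.PropositionalEquality using (_≡_)

data Formula (Var : Set) : Set where
  var  : Var → Formula Var
  ¬'_  : Formula Var → Formula Var
  _∧'_ : Formula Var → Formula Var → Formula Var
  □_   : Formula Var → Formula Var
  O[_∣_] : Formula Var → Formula Var → Formula Var

size : ∀ {Var} → Formula Var → ℕ
size (var x)      = 1
size (¬' ψ)       = suc (size ψ)
size (ψ₁ ∧' ψ₂)   = suc (size ψ₁ + size ψ₂)
size (□ ψ)        = suc (size ψ)
size O[ ψ₁ ∣ ψ₂ ] = suc (size ψ₁ + size ψ₂)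

data _⊑_ {Var : Set} : Formula Var → Formula Var → Set where
  here : ∀ {φ} → φ ⊑ φ
  in¬  : ∀ {ψ φ} → ψ ⊑ φ → ψ ⊑ (¬' φ)
  in∧₁ : ∀ {ψ φ₁ φ₂} → ψ ⊑ φ₁ → ψ ⊑ (φ₁ ∧' φ₂)
  in∧₂ : ∀ {ψ φ₁ φ₂} → ψ ⊑ φ₂ → ψ ⊑ (φ₁ ∧' φ₂)
  in□  : ∀ {ψ φ} → ψ ⊑ φ → ψ ⊑ (□ φ)
  inO₁ : ∀ {ψ φ₁ φ₂} → ψ ⊑ φ₁ → ψ ⊑ O[ φ₁ ∣ φ₂ ]
  inO₂ : ∀ {ψ φ₁ φ₂} → ψ ⊑ φ₂ → ψ ⊑ O[ φ₁ ∣ φ₂ ]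

Cond : ∀ {Var} → Formula Var → Formula Var → Set
Cond φ α = Σ[ γ ∈ Formula _ ] (O[ γ ∣ α ] ⊑ φ)

-- Preference structures ⟨W, ⪰, 𝕍⟩ (nonemptiness of W is stated separately)

record PModel (Var : Set) : Set₁ where
  field
    W   : Set
    _⪰_ : W → W → Set
    V   : Var → W → Set

  _≻_ : W → W → Set
  w₁ ≻ w₂ = (w₁ ⪰ w₂) × ¬ (w₂ ⪰ w₁)

  Max : (W → Set) → W → Set
  Max U v = U v × ¬ (Σ[ u ∈ W ] (U u × (u ≻ v)))

  Bet : W → W → Set
  Bet v w = w ≻ v

  ‖_‖ : Formula Var → W → Set
  ‖ var x ‖ w = V x w
  ‖ ¬' ψ ‖ w = ¬ (‖ ψ ‖ w)
  ‖ ψ₁ ∧' ψ₂ ‖ w = ‖ ψ₁ ‖ w × ‖ ψ₂ ‖ w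
  ‖ □ β ‖ w = ∀ v → ‖ β ‖ v
  ‖ O[ γ ∣ α ] ‖ w = ∀ v → Max ‖ α ‖ v → ‖ γ ‖ v

  _⊨ : Formula Var → Set
  ψ ⊨ = ∀ w → ‖ ψ ‖ w

open PModel public

_⊨_ : ∀ {Var} → PModel Var → Formula Var → Set
M ⊨ φ = PModel._⊨ M φ

NonEmpty : ∀ {Var} → PModel Var → Set
NonEmpty M = W M

record ChoiceFn (W : Set) : Set₁ where
  field
    rep     : (S : W → Set) → Σ W S → W
    rep∈    : ∀ (S : W → Set) (p : Σ W S) → S (rep S p)
    -- rep depends only on the subset (as a set), not on its presentation
    rep-ext : ∀ (S S' : W → Set) (p : Σ W S) (p' : Σ W S') → (∀ w → S w → S' w) → (∀ w → S' w → S w) →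
              rep S p ≡ rep S' p'

record Composite (W : Set) : Set₁ where
  field
    Lab    : Set              -- ambient type of label names
    IsLab  : Lab → Set        -- L ⊆ Lab
    _⪰L_   : Lab → Lab → Set
    Blk    : Lab → W → Set    -- U of the block ℬ(l)
    BlkRel : Lab → W → W → Set -- ⪰_U of the block ℬ(l)

module _ {Var : Set} (M : PModel Var) (C : Composite (W M)) where
  open Composite C

  GenWorld : Lab × W M → Set
  GenWorld (l , w) = IsLab l × Blk l w

  gen : PModel Var
  gen = record
    { W   = Refinement (Lab × W M) GenWorld
    ; _⪰_ = λ x y → let (l₁ , w₁) = value x ; (l₂ , w₂) = value y in
                    (l₁ ⪰L l₂) ⊎ ((l₁ ≡ l₂) × BlkRel l₁ w₁ w₂)
    ; V   = λ x p → let (l , w) = value p in V M x w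
    }

module _ {Var : Set} (M : PModel Var) (ch : ChoiceFn (W M)) (φ : Formula Var) where
  open ChoiceFn ch

  ∁ : (W M → Set) → W M → Set
  ∁ S w = ¬ S w

  Fal : W M → Set
  Fal w =
      (Σ[ p ∈ Σ (W M) (∁ (‖_‖ M φ)) ] (w ≡ rep (∁ (‖_‖ M φ)) p))
    ⊎ (Σ[ β ∈ Formula Var ] ((□ β) ⊑ φ) × ¬ (M ⊨ (□ β)) ×
         (Σ[ p ∈ Σ (W M) (∁ (‖_‖ M β)) ] (w ≡ rep (∁ (‖_‖ M β)) p)))
    ⊎ (Σ[ γ ∈ Formula Var ] Σ[ α ∈ Formula Var ] (O[ γ ∣ α ] ⊑ φ) × ¬ (M ⊨ O[ γ ∣ α ]) ×
         (Σ[ p ∈ Σ (W M) (λ v → Max M (‖_‖ M α) v × ¬ ‖_‖ M γ v) ]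
            (w ≡ rep (λ v → Max M (‖_‖ M α) v × ¬ ‖_‖ M γ v) p)))

  Sel : (W M → Set) → W M → Set
  Sel U w = Σ[ α ∈ Formula Var ] Cond φ α ×
              (Σ[ p ∈ Σ (W M) (λ v → ‖_‖ M α v × U v) ]
                 (w ≡ rep (λ v → ‖_‖ M α v × U v) p))

  data SLab : Set where
    f orb : W M → SLab
    all₁ all₂ all₃ : SLab

  IsSLab : SLab → Set
  IsSLab (f v)   = Fal v
  IsSLab (orb v) = Fal v
  IsSLab all₁ = ⊤
  IsSLab all₂ = ⊤
  IsSLab all₃ = ⊤

  data _⪰S_ : SLab → SLab → Set where
    orb⪰f    : ∀ v → orb v ⪰S f v
    all₁⪰orb : ∀ v → all₁ ⪰S orb v
    all₂⪰all₁ : all₂ ⪰S all₁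
    all₃⪰all₂ : all₃ ⪰S all₂
    all₁⪰all₃ : all₁ ⪰S all₃

  SBlk : SLab → W M → Set
  SBlk (f v) w   = w ≡ v
  SBlk (orb v) w = Sel (Bet M v) w
  SBlk all₁ w    = Sel (λ _ → ⊤) w
  SBlk all₂ w    = Sel (λ _ → ⊤) w
  SBlk all₃ w    = Sel (λ _ → ⊤) w

  SMC-E : Composite (W M)
  SMC-E = record
    { Lab = SLab ; IsLab = IsSLab ; _⪰L_ = _⪰S_ ; Blk = SBlk
    ; BlkRel = λ _ _ _ → ⊥ }

Card≤ : Set → ℕ → Set
Card≤ X n = Σ[ xs ∈ List X ] (length xs ≤ n × (∀ x → x ∈ xs))

{-# OPTIONS --safe #-}
module Submission where

-- Every subformula of φ has the same truth value at a world (l , w) of the generated model G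
-- as at w in M.  For □β and 𝒪(γ | α) this holds because every failure in M has a witness u in
-- Fal, sitting alone in the block f u; the block orb u directly above it contains an α-world
-- better than u in M whenever one exists, so u stays maximal among α-worlds in G exactly when it
-- is in M.  Conversely, an α-world in an orb- or all-block always has an α-world strictly above it
-- in an all-block (the all-blocks form the strict cycle all₁ ≺ all₂ ≺ all₃ ≺ all₁), so maximal
-- α-worlds of G lie in f-blocks.  For the size bound, Fal has at most 1 + |φ| elements and every
-- block at most |φ|, so G has at most (5 + 2|φ|)|φ| ≤ 7|φ|² worlds.

open import Defs
open import Level using (0ℓ)
open import Axiom.ExcludedMiddle using (ExcludedMiddle)
open import Axiom.DoubleNegationElimination using (em⇒dne)
open import Data.Nat using (ℕ; suc; _+_; _*_; _≤_; z≤n; s≤s)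
open import Data.Nat.Properties using (≤-refl; ≤-trans; ≤-reflexive; +-mono-≤; *-monoˡ-≤; *-identityʳ; m≤m+n)
open import Data.Nat.Tactic.RingSolver using (solve-∀)
open import Data.Product using (Σ; _×_; _,_; _,′_; proj₁; proj₂; Σ-syntax)
open import Data.Product.Function.NonDependent.Propositional using (_×-⇔_)
open import Data.Sum using (inj₁; inj₂)
open import Data.Empty using (⊥; ⊥-elim)
import Data.Empty.Irrelevant as Irrelevant
open import Data.Unit using (⊤; tt)
open import Data.List using (List; []; _∷_; _++_; length; map; concatMap)
open import Data.List.Properties using (length-++; length-map)
open import Data.List.Membership.Propositional using (_∈_; lose)
open import Data.List.Membership.Propositional.Properties using (∈-++⁺ˡ; ∈-++⁺ʳ; ∈-map⁺; ∈-concatMap⁺)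
open import Data.List.Relation.Unary.Any using (here; there)
open import Data.Refinement using (Refinement; value; _,_)
open import Data.Irrelevant using ([_])
open import Function using (_∘_; id)
open import Function.Bundles using (_⇔_; mk⇔; Equivalence)
open import Function.Construct.Identity using (⇔-id)
open import Function.Related.TypeIsomorphisms using (¬-cong-⇔)
open import Relation.Nullary using (¬_; Dec; yes; no)
open import Relation.Nullary.Decidable using (recompute)
open import Relation.Unary using (Pred; _⊆_; _∪_)
open import Relation.Binary.PropositionalEquality using (_≡_; refl; cong; cong₂; module ≡-Reasoning)

open Equivalence using (to; from)

private
  variable
    A B : Set
    m n k : ℕ
    P Q I : Pred A 0ℓ

length-concatMap-≤ : (g : A → List B) (xs : List A) →
                     (∀ x → length (g x) ≤ k) → length (concatMap g xs) ≤ length xs * k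
length-concatMap-≤ g []       bound = z≤n
length-concatMap-≤ g (x ∷ xs) bound rewrite length-++ (g x) {concatMap g xs} =
  +-mono-≤ (bound x) (length-concatMap-≤ g xs bound)

record AtMost {A : Set} (n : ℕ) (P : Pred A 0ℓ) : Set where
  constructor listing
  field
    elems   : List A
    length≤ : length elems ≤ n
    covers  : P ⊆ (_∈ elems)

open AtMost

atMost-∈ : (xs : List A) → AtMost (length xs) (_∈ xs)
atMost-∈ xs = listing xs ≤-refl id

atMost-⊆ : P ⊆ Q → AtMost n Q → AtMost n P
atMost-⊆ P⊆Q (listing xs len cov) = listing xs len (cov ∘ P⊆Q)

atMost-≤ : m ≤ n → AtMost m P → AtMost n P
atMost-≤ m≤n (listing xs len cov) = listing xs (≤-trans len m≤n) cov

atMost-∪ : AtMost m P → AtMost n Q → AtMost (m + n) (P ∪ Q)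
atMost-∪ (listing xs lenx covx) (listing ys leny covy) =
  listing (xs ++ ys)
          (≤-trans (≤-reflexive (length-++ xs)) (+-mono-≤ lenx leny))
          λ { (inj₁ p) → ∈-++⁺ˡ (covx p) ; (inj₂ q) → ∈-++⁺ʳ xs (covy q) }

atMost-image : (g : A → B) → AtMost n P → AtMost n (λ b → Σ[ a ∈ A ] P a × b ≡ g a)
atMost-image g (listing xs len cov) =
  listing (map g xs)
          (≤-trans (≤-reflexive (length-map g xs)) len)
          λ { (a , pa , refl) → ∈-map⁺ g (cov pa) }

atMost-Σ : {Q : A → Pred B 0ℓ} → AtMost m I → (∀ i → AtMost k (Q i)) →
           AtMost (m * k) (λ p → I (proj₁ p) × Q (proj₁ p) (proj₂ p))
atMost-Σ {A = A} {B = B} {k = k} bI bQ =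
  listing (concatMap fibre (elems bI))
          (≤-trans (length-concatMap-≤ fibre (elems bI) length-fibre) (*-monoˡ-≤ k (length≤ bI)))
          λ { {i , b} (Ii , Qib) →
                ∈-concatMap⁺ fibre (lose (covers bI Ii) (∈-map⁺ (i ,′_) (covers (bQ i) Qib))) }
  where
  fibre : A → List (A × B)
  fibre i = map (i ,′_) (elems (bQ i))

  length-fibre : ∀ i → length (fibre i) ≤ k
  length-fibre i = ≤-trans (≤-reflexive (length-map (i ,′_) (elems (bQ i)))) (length≤ (bQ i))

atMost-⋃ : {Q : A → Pred B 0ℓ} → AtMost m I → (∀ i → AtMost k (Q i)) →
           AtMost (m * k) (λ b → Σ[ i ∈ A ] I i × Q i b)
atMost-⋃ bI bQ =
  atMost-⊆ (λ { (i , Ii , Qib) → (i , _) , (Ii , Qib) , refl }) (atMost-image proj₂ (atMost-Σ bI bQ))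

refinementsOf : (a : A) → Dec (P a) → List (Refinement A P)
refinementsOf a (yes pa) = (a , [ pa ]) ∷ []
refinementsOf a (no _)   = []

length-refinementsOf : (a : A) (d : Dec (P a)) → length (refinementsOf {P = P} a d) ≤ 1
length-refinementsOf a (yes _) = s≤s z≤n
length-refinementsOf a (no _)  = z≤n

∈-refinementsOf : ∀ {a} (d : Dec (P a)) .(pa : P a) → (a , [ pa ]) ∈ refinementsOf {P = P} a d
∈-refinementsOf (yes _)  pa = here refl
∈-refinementsOf (no ¬pa) pa = Irrelevant.⊥-elim (¬pa pa)

-- The proof component of a refinement is irrelevant: excluded middle both enumerates the
-- refinements over a cover of P and recovers a usable proof of P for an arbitrary one.
Card≤-Refinement : ExcludedMiddle 0ℓ → AtMost n P → Card≤ (Refinement A P) n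
Card≤-Refinement {A = A} {P = P} em bP =
  concatMap candidates (elems bP) ,
  ≤-trans (length-concatMap-≤ candidates (elems bP) (λ a → length-refinementsOf {P = P} a em))
          (≤-trans (≤-reflexive (*-identityʳ _)) (length≤ bP)) ,
  λ { (a , [ pa ]) →
        ∈-concatMap⁺ candidates (lose (covers bP (recompute em pa)) (∈-refinementsOf {P = P} em pa)) }
  where
  candidates : A → List (Refinement A P)
  candidates a = refinementsOf a em

module _ {X : Set} (ch : ChoiceFn X) where
  open ChoiceFn ch

  Chosen : Pred X 0ℓ → Pred X 0ℓ
  Chosen S x = Σ[ p ∈ Σ X S ] x ≡ rep S p

  atMost-Chosen : ExcludedMiddle 0ℓ → (S : Pred X 0ℓ) → AtMost 1 (Chosen S)
  atMost-Chosen em S with em {Σ X S}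
  ... | yes p = listing (rep S p ∷ []) ≤-refl
                  λ { (q , refl) → here (rep-ext S S q p (λ _ → id) (λ _ → id)) }
  ... | no ¬p = listing [] z≤n λ { (q , _) → ⊥-elim (¬p q) }

module _ {Var : Set} where

  ⊑-trans : {ψ χ φ : Formula Var} → ψ ⊑ χ → χ ⊑ φ → ψ ⊑ φ
  ⊑-trans p here     = p
  ⊑-trans p (in¬ q)  = in¬ (⊑-trans p q)
  ⊑-trans p (in∧₁ q) = in∧₁ (⊑-trans p q)
  ⊑-trans p (in∧₂ q) = in∧₂ (⊑-trans p q)
  ⊑-trans p (in□ q)  = in□ (⊑-trans p q)
  ⊑-trans p (inO₁ q) = inO₁ (⊑-trans p q)
  ⊑-trans p (inO₂ q) = inO₂ (⊑-trans p q)

  subformulas properSubformulas : Formula Var → List (Formula Var)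
  subformulas φ = φ ∷ properSubformulas φ
  properSubformulas (var x)      = []
  properSubformulas (¬' ψ)       = subformulas ψ
  properSubformulas (ψ ∧' χ)     = subformulas ψ ++ subformulas χ
  properSubformulas (□ ψ)        = subformulas ψ
  properSubformulas O[ ψ ∣ χ ]   = subformulas ψ ++ subformulas χ

  length-subformulas : (φ : Formula Var) → length (subformulas φ) ≡ size φ
  length-subformulas-++ : (ψ χ : Formula Var) → length (subformulas ψ ++ subformulas χ) ≡ size ψ + size χ
  length-subformulas (var x)    = refl
  length-subformulas (¬' ψ)     = cong suc (length-subformulas ψ)
  length-subformulas (ψ ∧' χ)   = cong suc (length-subformulas-++ ψ χ)
  length-subformulas (□ ψ)      = cong suc (length-subformulas ψ)
  length-subformulas O[ ψ ∣ χ ] = cong suc (length-subformulas-++ ψ χ)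

  length-subformulas-++ ψ χ = begin
    length (subformulas ψ ++ subformulas χ)         ≡⟨ length-++ (subformulas ψ) ⟩
    length (subformulas ψ) + length (subformulas χ) ≡⟨ cong₂ _+_ (length-subformulas ψ) (length-subformulas χ) ⟩
    size ψ + size χ                                 ∎
    where open ≡-Reasoning

  ⊑⇒∈-subformulas : {ψ φ : Formula Var} → ψ ⊑ φ → ψ ∈ subformulas φ
  ⊑⇒∈-subformulas here = here refl
  ⊑⇒∈-subformulas (in¬ p)  = there (⊑⇒∈-subformulas p)
  ⊑⇒∈-subformulas (in∧₁ p) = there (∈-++⁺ˡ (⊑⇒∈-subformulas p))
  ⊑⇒∈-subformulas (in∧₂ {φ₁ = ψ} p) = there (∈-++⁺ʳ (subformulas ψ) (⊑⇒∈-subformulas p))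
  ⊑⇒∈-subformulas (in□ p)  = there (⊑⇒∈-subformulas p)
  ⊑⇒∈-subformulas (inO₁ p) = there (∈-++⁺ˡ (⊑⇒∈-subformulas p))
  ⊑⇒∈-subformulas (inO₂ {φ₁ = ψ} p) = there (∈-++⁺ʳ (subformulas ψ) (⊑⇒∈-subformulas p))

  atMost-⊑ : (φ : Formula Var) → AtMost (size φ) (_⊑ φ)
  atMost-⊑ φ = atMost-≤ (≤-reflexive (length-subformulas φ))
                        (atMost-⊆ ⊑⇒∈-subformulas (atMost-∈ (subformulas φ)))

  1≤size : (φ : Formula Var) → 1 ≤ size φ
  1≤size (var x)    = s≤s z≤n
  1≤size (¬' ψ)     = s≤s z≤n
  1≤size (ψ ∧' χ)   = s≤s z≤n
  1≤size (□ ψ)      = s≤s z≤n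
  1≤size O[ ψ ∣ χ ] = s≤s z≤n

quadratic-bound : ∀ n → 1 ≤ n → (3 + (suc n + suc n)) * n ≤ 7 * (n * n)
quadratic-bound (suc m) _ = ≤-trans (m≤m+n _ (5 * (suc m * m))) (≤-reflexive (identity m))
  where
  identity : ∀ m → (3 + (suc (suc m) + suc (suc m))) * suc m + 5 * (suc m * m) ≡ 7 * (suc m * suc m)
  identity = solve-∀

module SMC (em : ExcludedMiddle 0ℓ) {Var : Set} (φ : Formula Var) (M : PModel Var) (ch : ChoiceFn (W M)) where
  open ChoiceFn ch
  open PModel M using () renaming (W to Wᴹ; _≻_ to _≻ᴹ_; ‖_‖ to ‖_‖ᴹ; Max to Maxᴹ)

  G : PModel Var
  G = gen M (SMC-E M ch φ)

  open PModel G using () renaming (W to Wᴳ; _≻_ to _≻ᴳ_; ‖_‖ to ‖_‖ᴳ; Max to Maxᴳ)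

  Label : Set
  Label = SLab M ch φ

  _⪰ˡ_ : Label → Label → Set
  _⪰ˡ_ = _⪰S_ M ch φ

  InFal : Pred Wᴹ 0ℓ
  InFal = Fal M ch φ

  InSel : Pred Wᴹ 0ℓ → Pred Wᴹ 0ℓ
  InSel = Sel M ch φ

  IsLabel : Pred Label 0ℓ
  IsLabel = IsSLab M ch φ

  InBlock : Label → Pred Wᴹ 0ℓ
  InBlock = SBlk M ch φ

  dne : {P : Set} → ¬ ¬ P → P
  dne = em⇒dne em

  Counterexamples : Formula Var → Pred Wᴹ 0ℓ
  Counterexamples (□ β)        v = ¬ ‖ β ‖ᴹ v
  Counterexamples O[ γ ∣ α ]   v = Maxᴹ ‖ α ‖ᴹ v × ¬ ‖ γ ‖ᴹ v
  Counterexamples _            _ = ⊥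

  Fal⊆⋃ : InFal ⊆ Chosen ch (λ w → ¬ ‖ φ ‖ᴹ w) ∪
                  (λ w → Σ[ ψ ∈ Formula Var ] ψ ⊑ φ × Chosen ch (Counterexamples ψ) w)
  Fal⊆⋃ (inj₁ c)                          = inj₁ c
  Fal⊆⋃ (inj₂ (inj₁ (β , s , _ , c)))     = inj₂ (□ β , s , c)
  Fal⊆⋃ (inj₂ (inj₂ (γ , α , s , _ , c))) = inj₂ (O[ γ ∣ α ] , s , c)

  atMost-Fal : AtMost (suc (size φ)) InFal
  atMost-Fal = atMost-⊆ Fal⊆⋃ (atMost-≤ (≤-reflexive (cong suc (*-identityʳ (size φ))))
    (atMost-∪ (atMost-Chosen ch em _) (atMost-⋃ (atMost-⊑ φ) (atMost-Chosen ch em ∘ Counterexamples))))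

  Antecedent : Pred Wᴹ 0ℓ → Formula Var → Pred Wᴹ 0ℓ
  Antecedent U O[ γ ∣ α ] v = ‖ α ‖ᴹ v × U v
  Antecedent U _          _ = ⊥

  Sel⊆⋃ : ∀ {U} → InSel U ⊆ (λ w → Σ[ ψ ∈ Formula Var ] ψ ⊑ φ × Chosen ch (Antecedent U ψ) w)
  Sel⊆⋃ (α , (γ , s) , c) = O[ γ ∣ α ] , s , c

  atMost-Sel : ∀ U → AtMost (size φ) (InSel U)
  atMost-Sel U = atMost-⊆ Sel⊆⋃ (atMost-≤ (≤-reflexive (*-identityʳ (size φ)))
    (atMost-⋃ (atMost-⊑ φ) (atMost-Chosen ch em ∘ Antecedent U)))

  IsLabel⊆ : IsLabel ⊆ (_∈ all₁ ∷ all₂ ∷ all₃ ∷ []) ∪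
                        ((λ l → Σ[ v ∈ Wᴹ ] InFal v × l ≡ f v) ∪ (λ l → Σ[ v ∈ Wᴹ ] InFal v × l ≡ orb v))
  IsLabel⊆ {f v}   fv = inj₂ (inj₁ (v , fv , refl))
  IsLabel⊆ {orb v} fv = inj₂ (inj₂ (v , fv , refl))
  IsLabel⊆ {all₁}  _  = inj₁ (here refl)
  IsLabel⊆ {all₂}  _  = inj₁ (there (here refl))
  IsLabel⊆ {all₃}  _  = inj₁ (there (there (here refl)))

  atMost-IsLabel : AtMost (3 + (suc (size φ) + suc (size φ))) IsLabel
  atMost-IsLabel = atMost-⊆ IsLabel⊆
    (atMost-∪ (atMost-∈ _) (atMost-∪ (atMost-image f atMost-Fal) (atMost-image orb atMost-Fal)))

  atMost-InBlock : ∀ l → AtMost (size φ) (InBlock l)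
  atMost-InBlock (f v)   = atMost-≤ (1≤size φ) (atMost-⊆ (λ { refl → here refl }) (atMost-∈ (v ∷ [])))
  atMost-InBlock (orb v) = atMost-Sel _
  atMost-InBlock all₁    = atMost-Sel _
  atMost-InBlock all₂    = atMost-Sel _
  atMost-InBlock all₃    = atMost-Sel _

  card-G : Card≤ Wᴳ (7 * (size φ * size φ))
  card-G = Card≤-Refinement em
    (atMost-≤ (quadratic-bound (size φ) (1≤size φ)) (atMost-Σ atMost-IsLabel atMost-InBlock))

  label : Wᴳ → Label
  label x = proj₁ (value x)

  world : Wᴳ → Wᴹ
  world x = proj₂ (value x)

  label-valid : (x : Wᴳ) → IsLabel (label x)
  label-valid (_ , [ p ]) = recompute em (proj₁ p)

  world-in-block : (x : Wᴳ) → InBlock (label x) (world x)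
  world-in-block (_ , [ p ]) = recompute em (proj₂ p)

  ⪰ˡ-asym : ∀ {l₁ l₂} → l₁ ⪰ˡ l₂ → ¬ l₂ ⪰ˡ l₁
  ⪰ˡ-asym (orb⪰f _)    ()
  ⪰ˡ-asym (all₁⪰orb _) ()
  ⪰ˡ-asym all₂⪰all₁    ()
  ⪰ˡ-asym all₃⪰all₂    ()
  ⪰ˡ-asym all₁⪰all₃    ()

  ⪰ˡ⇒≻ᴳ : ∀ {x y} → label x ⪰ˡ label y → x ≻ᴳ y
  ⪰ˡ⇒≻ᴳ x⪰y = inj₁ x⪰y , λ { (inj₁ y⪰x) → ⪰ˡ-asym x⪰y y⪰x ; (inj₂ (_ , ())) }

  ≻ᴳ⇒⪰ˡ : ∀ {x y} → x ≻ᴳ y → label x ⪰ˡ label y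
  ≻ᴳ⇒⪰ˡ (inj₁ x⪰y , _)      = x⪰y
  ≻ᴳ⇒⪰ˡ (inj₂ (_ , ()) , _)

  Sel⊆ : ∀ {U} → InSel U ⊆ U
  Sel⊆ (_ , _ , p , refl) = proj₂ (rep∈ _ p)

  above-f : ∀ {l u w} → l ⪰ˡ f u → InBlock l w → w ≻ᴹ u
  above-f (orb⪰f _) = Sel⊆

  f-world : ∀ {u} → InFal u → Wᴳ
  f-world {u} fu = (f u , u) , [ fu , refl ]

  Agrees : Formula Var → Set
  Agrees ψ = ∀ x → ‖ ψ ‖ᴳ x ⇔ ‖ ψ ‖ᴹ (world x)

  module _ {γ α : Formula Var} (s : O[ γ ∣ α ] ⊑ φ) (agα : Agrees α) where

    α-world-above : ∀ {l y} (U : Pred Wᴹ 0ℓ) → l ⪰ˡ label y → IsLabel l → InSel U ⊆ InBlock l →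
                    Σ[ v ∈ Wᴹ ] ‖ α ‖ᴹ v × U v → Σ[ z ∈ Wᴳ ] ‖ α ‖ᴳ z × z ≻ᴳ y
    α-world-above {l} {y} U l⪰y isl sel⊆ p =
      z , from (agα z) (proj₁ (rep∈ _ p)) , ⪰ˡ⇒≻ᴳ {z} {y} l⪰y
      where
      z : Wᴳ
      z = (l , rep _ p) , [ isl , sel⊆ (α , (γ , s) , p , refl) ]

    below-all-not-max : ∀ {y} l → l ⪰ˡ label y → IsLabel l → InSel (λ _ → ⊤) ⊆ InBlock l →
                        ¬ Maxᴳ ‖ α ‖ᴳ y
    below-all-not-max {y} l l⪰y isl sel⊆ (αy , noneAbove) =
      noneAbove (α-world-above {y = y} (λ _ → ⊤) l⪰y isl sel⊆ (world y , to (agα y) αy , tt))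

    world-max : ∀ {y} → Maxᴳ ‖ α ‖ᴳ y → Maxᴹ ‖ α ‖ᴹ (world y)
    world-max {y@((f v , _) , _)} (αy , noneAbove) with world-in-block y
    ... | refl = to (agα y) αy , λ (u , αu , u≻v) →
      noneAbove (α-world-above {y = y} (Bet M v) (orb⪰f v) (label-valid y) id (u , αu , u≻v))
    world-max {(orb v , _) , _} maxy = ⊥-elim (below-all-not-max all₁ (all₁⪰orb v) tt id maxy)
    world-max {(all₁ , _) , _}  maxy = ⊥-elim (below-all-not-max all₂ all₂⪰all₁ tt id maxy)
    world-max {(all₂ , _) , _}  maxy = ⊥-elim (below-all-not-max all₃ all₃⪰all₂ tt id maxy)
    world-max {(all₃ , _) , _}  maxy = ⊥-elim (below-all-not-max all₁ all₁⪰all₃ tt id maxy)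

    f-world-max : ∀ {u} (fu : InFal u) → Maxᴹ ‖ α ‖ᴹ u → Maxᴳ ‖ α ‖ᴳ (f-world fu)
    f-world-max fu (αu , noneAbove) =
      from (agα (f-world fu)) αu ,
      λ (z , αz , z≻) →
        noneAbove (world z , to (agα z) αz , above-f (≻ᴳ⇒⪰ˡ {z} {f-world fu} z≻) (world-in-block z))

  □-agrees : ∀ {β} → (□ β) ⊑ φ → Agrees β → (∀ x → ‖ β ‖ᴳ x) ⇔ (∀ v → ‖ β ‖ᴹ v)
  □-agrees {β} s agβ =
    mk⇔ (λ βᴳ v → dne λ ¬βv → refuted-in-G ¬βv βᴳ) (λ βᴹ x → from (agβ x) (βᴹ (world x)))
    where
    refuted-in-G : ∀ {v} → ¬ ‖ β ‖ᴹ v → ¬ (∀ x → ‖ β ‖ᴳ x)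
    refuted-in-G {v} ¬βv βᴳ = rep∈ _ p (to (agβ (f-world fu)) (βᴳ (f-world fu)))
      where
      p : Σ[ w ∈ Wᴹ ] ¬ ‖ β ‖ᴹ w
      p = v , ¬βv
      fu : InFal (rep _ p)
      fu = inj₂ (inj₁ (β , s , (λ □β → ¬βv (□β v v)) , p , refl))

  O-agrees : ∀ {γ α} → O[ γ ∣ α ] ⊑ φ → Agrees γ → Agrees α →
             (∀ y → Maxᴳ ‖ α ‖ᴳ y → ‖ γ ‖ᴳ y) ⇔ (∀ v → Maxᴹ ‖ α ‖ᴹ v → ‖ γ ‖ᴹ v)
  O-agrees {γ} {α} s agγ agα =
    mk⇔ (λ Oᴳ v maxv → dne λ ¬γv → refuted-in-G maxv ¬γv Oᴳ)
        (λ Oᴹ y maxy → from (agγ y) (Oᴹ (world y) (world-max s agα maxy)))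
    where
    refuted-in-G : ∀ {v} → Maxᴹ ‖ α ‖ᴹ v → ¬ ‖ γ ‖ᴹ v → ¬ (∀ y → Maxᴳ ‖ α ‖ᴳ y → ‖ γ ‖ᴳ y)
    refuted-in-G {v} maxv ¬γv Oᴳ =
      proj₂ (rep∈ _ p) (to (agγ (f-world fu)) (Oᴳ (f-world fu) (f-world-max s agα fu (proj₁ (rep∈ _ p)))))
      where
      p : Σ[ w ∈ Wᴹ ] Maxᴹ ‖ α ‖ᴹ w × ¬ ‖ γ ‖ᴹ w
      p = v , maxv , ¬γv
      fu : InFal (rep _ p)
      fu = inj₂ (inj₂ (γ , α , s , (λ O → ¬γv (O v v maxv)) , p , refl))

  truth : ∀ {ψ} → ψ ⊑ φ → Agrees ψ
  truth {var _}      s x = ⇔-id _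
  truth {¬' ψ}       s x = ¬-cong-⇔ (truth (⊑-trans (in¬ here) s) x)
  truth {ψ ∧' χ}     s x = truth (⊑-trans (in∧₁ here) s) x ×-⇔ truth (⊑-trans (in∧₂ here) s) x
  truth {□ β}        s x = □-agrees s (truth (⊑-trans (in□ here) s))
  truth {O[ γ ∣ α ]} s x = O-agrees s (truth (⊑-trans (inO₁ here) s)) (truth (⊑-trans (inO₂ here) s))

  G-refutes : ¬ M ⊨ φ → Σ[ x ∈ Wᴳ ] ¬ ‖ φ ‖ᴳ x
  G-refutes M⊭φ = f-world fu , λ φx → rep∈ _ p (to (truth here (f-world fu)) φx)
    where
    p : Σ[ w ∈ Wᴹ ] ¬ ‖ φ ‖ᴹ w
    p = dne λ ¬p → M⊭φ λ w → dne λ ¬φw → ¬p (w , ¬φw)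
    fu : InFal (rep _ p)
    fu = inj₁ (p , refl)

theorem3p11 : ExcludedMiddle 0ℓ →
    Σ ℕ (λ C → ∀ {Var : Set} (φ : Formula Var) (M : PModel Var) (ch : ChoiceFn (W M)) →
      NonEmpty M → ¬ (M ⊨ φ) →
      NonEmpty (gen M (SMC-E M ch φ)) × ¬ (gen M (SMC-E M ch φ) ⊨ φ) ×
      Card≤ (W (gen M (SMC-E M ch φ))) (C * (size φ * size φ)))
theorem3p11 em = 7 , λ φ M ch _ M⊭φ →
  let open SMC em φ M ch
      (x , ¬φx) = G-refutes M⊭φ
  in x , (λ G⊨φ → ¬φx (G⊨φ x)) , card-G
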